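{- Let $n\ge 4$ be an integer and $W_{1,n}$ the wheel graph. Then every automorphism of $F_2(W_{1,n})$ is induced by an automorphism of $W_{1,n}$, i.e. $\mathrm{Aut}(F_2(W_{1,n}))=\mathrm{Aut}(W_{1,n})$ (the dihedral group of order $2n$).
   Context: The wheel graph $W_{1,n}$ ($n\ge 3$) is the join $K_1+C_n$: vertex set $\{v,u_1,\dots,u_n\}$, with $u_i\sim u_{i+1}$ for $1\le i\le n-1$, $u_1\sim u_n$, and $v$ adjacent to every $u_i$. For a graph $\Gamma$, the $2$-token graph $F_2(\Gamma)$ has as vertices all $2$-element subsets of $V(\Gamma)$, two being adjacent iff their symmetric difference is an edge of $\Gamma$. An automorphism $\theta$ of $\Gamma$ induces the automorphism $\{a,b\}\mapsto\{\theta(a),\theta(b)\}$ of $F_2(\Gamma)$; $\mathrm{Aut}(F_2(\Gamma))=\mathrm{Aut}(\Gamma)$ means every automorphism of $F_2(\Gamma)$ is of this form. -}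

module Defs where

open import Data.Nat using (ℕ; zero; suc; _+_; _≤_)
open import Data.Fin using (Fin; toℕ) renaming (zero to fz; suc to fs)
import Data.Fin as F
open import Data.Product using (Σ; ∃; ∃-syntax; _×_; _,_; proj₁; proj₂)
open import Data.Sum using (_⊎_)
open import Data.Empty using (⊥)
open import Relation.Binary.PropositionalEquality using (_≡_)
open import Function.Bundles using (_↔_; Inverse)
open import Level using (0ℓ)

record Graph : Set₁ where
  field
    V   : Set
    Adj : V → V → Set

open Graph public

record Automorphism (Γ : Graph) : Set where
  field
    perm     : V Γ ↔ V Γ
    preserve : ∀ x y → Adj Γ x y → Adj Γ (Inverse.to perm x) (Inverse.to perm y)
    reflect  : ∀ x y → Adj Γ (Inverse.to perm x) (Inverse.to perm y) → Adj Γ x y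

CycAdj : (n : ℕ) → Fin n → Fin n → Set
CycAdj n i j =
    suc (toℕ i) ≡ toℕ j
  ⊎ suc (toℕ j) ≡ toℕ i
  ⊎ (toℕ i ≡ 0 × suc (toℕ j) ≡ n)
  ⊎ (toℕ j ≡ 0 × suc (toℕ i) ≡ n)

-- Wheel W_{1,n} = K_1 + C_n on Fin (suc n): 0 is the hub v,
-- (suc i) is the rim vertex u_{i+1}.
WheelAdj : (n : ℕ) → Fin (suc n) → Fin (suc n) → Set
WheelAdj n fz     fz     = ⊥
WheelAdj n fz     (fs j) = Data.Unit.⊤ where import Data.Unit
WheelAdj n (fs i) fz     = Data.Unit.⊤ where import Data.Unit
WheelAdj n (fs i) (fs j) = CycAdj n i j

Wheel : ℕ → Graph
Wheel n = record { V = Fin (suc n) ; Adj = WheelAdj n }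

Pair₂ : ℕ → Set
Pair₂ m = Σ (Fin m × Fin m) λ p → proj₁ p F.< proj₂ p

_≐⟨_,_⟩ : ∀ {m} → Pair₂ m → Fin m → Fin m → Set
((a , b) , _) ≐⟨ x , y ⟩ = (a ≡ x × b ≡ y) ⊎ (a ≡ y × b ≡ x)

-- Token-graph adjacency: the symmetric difference of A and B is an edge,
-- i.e. A = {x,y}, B = {x,z} and y ~ z in Γ (then A △ B = {y,z}).
TokAdj : ∀ {m} → (Fin m → Fin m → Set) → Pair₂ m → Pair₂ m → Set
TokAdj adj A B = ∃[ x ] ∃[ y ] ∃[ z ] (A ≐⟨ x , y ⟩ × B ≐⟨ x , z ⟩ × adj y z)

Token₂ : (m : ℕ) → (Fin m → Fin m → Set) → Graph
Token₂ m adj = record { V = Pair₂ m ; Adj = TokAdj adj }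

InducedBy : ∀ {m} {adj : Fin m → Fin m → Set} →
            Automorphism (Token₂ m adj) →
            Automorphism (record { V = Fin m ; Adj = adj }) → Set
InducedBy φ θ =
  ∀ (A : Pair₂ _) →
    Inverse.to (Automorphism.perm φ) A
      ≐⟨ Inverse.to (Automorphism.perm θ) (proj₁ (proj₁ A))
       , Inverse.to (Automorphism.perm θ) (proj₂ (proj₁ A)) ⟩

-- In F₂(W_{1,n}) a pair {v,u_k} through the hub has, inside its neighbourhood, a walk
-- y₁ … y₅ with yₗ ≠ yₗ₊₂: its neighbourhood induces a path on n + 1 ≥ 5 vertices.
-- A rim pair {u_i,u_j} has no such walk: since the rim C_n is triangle-free for n ≥ 4,
-- a neighbour of {u_i,u_j} with two distinct common neighbours with it is {v,u_i} or
-- {v,u_j}, and y₂, y₃, y₄ would be three distinct elements of a two-element set.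
-- Hence every automorphism φ of F₂(W_{1,n}) permutes the pairs {v,u_k}. As two such
-- pairs are adjacent exactly when their rim vertices are, the induced permutation of the
-- rim is an automorphism of C_n, which extends to θ ∈ Aut(W_{1,n}) fixing the hub.
-- Finally {u_i,u_j} is the only rim pair adjacent to both {v,u_i} and {v,u_j}, so
-- φ{u_i,u_j} = {θu_i,θu_j}.
module Submission where

open import Defs
open import Data.Nat using (ℕ; zero; suc; _+_; _≤_; _<_; z≤n; s≤s; _<?_)
open import Data.Nat.Properties
  using (<-irrefl; <-asym; <-irrelevant; <⇒≤; ≤-antisym; ≮⇒≥; +-identityʳ; +-suc; +-cancelˡ-≡; +-mono-≤; ≤-pred)
import Data.Nat.Properties as ℕ
open import Data.Nat.GeneralisedArithmetic using (fold)
open import Data.Fin using (Fin; toℕ; fromℕ<; lift) renaming (zero to fz; suc to fs)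
open import Data.Fin.Properties using (toℕ-injective; toℕ<n; toℕ-fromℕ<; suc-injective; _≟_; <-cmp)
open import Data.Product using (∃-syntax; ∃₂; _×_; _,_; proj₁; proj₂)
open import Data.Sum using (_⊎_; inj₁; inj₂)
open import Data.Unit using (tt)
open import Data.Empty using (⊥; ⊥-elim)
open import Function.Base using (_∘_)
open import Function.Bundles using (Inverse; Injection; mk↔ₛ′)
open import Function.Properties.Inverse using (↔-sym; ↔⇒↣)
open import Relation.Nullary using (¬_; yes; no)
open import Relation.Binary.Definitions using (Symmetric; Irreflexive; tri<; tri≈; tri>)
open import Relation.Binary.PropositionalEquality
open ≡-Reasoning

no-three-distinct-among-two : {A : Set} {a b x y z : A} →
  x ≡ a ⊎ x ≡ b → y ≡ a ⊎ y ≡ b → z ≡ a ⊎ z ≡ b → x ≢ y → y ≢ z → x ≢ z → ⊥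
no-three-distinct-among-two (inj₁ refl) (inj₁ refl) _ x≢y _ _ = x≢y refl
no-three-distinct-among-two (inj₂ refl) (inj₂ refl) _ x≢y _ _ = x≢y refl
no-three-distinct-among-two _ (inj₁ refl) (inj₁ refl) _ y≢z _ = y≢z refl
no-three-distinct-among-two _ (inj₂ refl) (inj₂ refl) _ y≢z _ = y≢z refl
no-three-distinct-among-two (inj₁ refl) (inj₂ refl) (inj₁ refl) _ _ x≢z = x≢z refl
no-three-distinct-among-two (inj₂ refl) (inj₁ refl) (inj₂ refl) _ _ x≢z = x≢z refl

-- Automorphisms

⟦_⟧ : {Γ : Graph} → Automorphism Γ → V Γ → V Γ
⟦ α ⟧ = Inverse.to (Automorphism.perm α)

_⁻¹ : {Γ : Graph} → Automorphism Γ → Automorphism Γ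
_⁻¹ {Γ} α = record
  { perm     = ↔-sym perm
  ; preserve = λ x y xy → reflect (from x) (from y)
                 (subst₂ (Adj Γ) (sym (strictlyInverseˡ x)) (sym (strictlyInverseˡ y)) xy)
  ; reflect  = λ x y xy → subst₂ (Adj Γ) (strictlyInverseˡ x) (strictlyInverseˡ y)
                 (preserve (from x) (from y) xy)
  }
  where open Automorphism α
        open Inverse perm

⁻¹-inverseˡ : {Γ : Graph} (α : Automorphism Γ) (x : V Γ) → ⟦ α ⟧ (⟦ α ⁻¹ ⟧ x) ≡ x
⁻¹-inverseˡ α = Inverse.strictlyInverseˡ (Automorphism.perm α)

⁻¹-inverseʳ : {Γ : Graph} (α : Automorphism Γ) (x : V Γ) → ⟦ α ⁻¹ ⟧ (⟦ α ⟧ x) ≡ x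
⁻¹-inverseʳ α = Inverse.strictlyInverseʳ (Automorphism.perm α)

record NeighbourhoodWalk₄ (Γ : Graph) (X : V Γ) : Set where
  field
    y₁ y₂ y₃ y₄ y₅ : V Γ
    X~y₁ : Adj Γ X y₁
    X~y₂ : Adj Γ X y₂
    X~y₃ : Adj Γ X y₃
    X~y₄ : Adj Γ X y₄
    X~y₅ : Adj Γ X y₅
    y₁~y₂ : Adj Γ y₁ y₂
    y₂~y₃ : Adj Γ y₂ y₃
    y₃~y₄ : Adj Γ y₃ y₄
    y₄~y₅ : Adj Γ y₄ y₅
    y₁≢y₃ : y₁ ≢ y₃
    y₂≢y₄ : y₂ ≢ y₄
    y₃≢y₅ : y₃ ≢ y₅

NeighbourhoodWalk₄-transport : {Γ : Graph} (α : Automorphism Γ) {X : V Γ} →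
  NeighbourhoodWalk₄ Γ X → NeighbourhoodWalk₄ Γ (⟦ α ⟧ X)
NeighbourhoodWalk₄-transport α {X} w = record
  { y₁ = ⟦ α ⟧ y₁ ; y₂ = ⟦ α ⟧ y₂ ; y₃ = ⟦ α ⟧ y₃ ; y₄ = ⟦ α ⟧ y₄ ; y₅ = ⟦ α ⟧ y₅
  ; X~y₁ = preserve X y₁ X~y₁
  ; X~y₂ = preserve X y₂ X~y₂
  ; X~y₃ = preserve X y₃ X~y₃
  ; X~y₄ = preserve X y₄ X~y₄
  ; X~y₅ = preserve X y₅ X~y₅
  ; y₁~y₂ = preserve y₁ y₂ y₁~y₂
  ; y₂~y₃ = preserve y₂ y₃ y₂~y₃
  ; y₃~y₄ = preserve y₃ y₄ y₃~y₄
  ; y₄~y₅ = preserve y₄ y₅ y₄~y₅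
  ; y₁≢y₃ = y₁≢y₃ ∘ injective
  ; y₂≢y₄ = y₂≢y₄ ∘ injective
  ; y₃≢y₅ = y₃≢y₅ ∘ injective
  }
  where open NeighbourhoodWalk₄ w
        open Automorphism α
        open Injection (↔⇒↣ perm) using (injective)

-- Unordered pairs and the token graph

module _ {m : ℕ} where

  ≐-swap : (A : Pair₂ m) {x y : Fin m} → A ≐⟨ x , y ⟩ → A ≐⟨ y , x ⟩
  ≐-swap _ (inj₁ p) = inj₂ p
  ≐-swap _ (inj₂ p) = inj₁ p

  ≐-distinct : (A : Pair₂ m) {x y : Fin m} → A ≐⟨ x , y ⟩ → x ≢ y
  ≐-distinct (_ , a<b) (inj₁ (refl , refl)) refl = <-irrefl refl a<b
  ≐-distinct (_ , a<b) (inj₂ (refl , refl)) refl = <-irrefl refl a<b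

  ≐-elements : (A : Pair₂ m) {x y u v : Fin m} → A ≐⟨ x , y ⟩ → A ≐⟨ u , v ⟩ →
               (x ≡ u × y ≡ v) ⊎ (x ≡ v × y ≡ u)
  ≐-elements _ (inj₁ (refl , refl)) (inj₁ (refl , refl)) = inj₁ (refl , refl)
  ≐-elements _ (inj₁ (refl , refl)) (inj₂ (refl , refl)) = inj₂ (refl , refl)
  ≐-elements _ (inj₂ (refl , refl)) (inj₁ (refl , refl)) = inj₂ (refl , refl)
  ≐-elements _ (inj₂ (refl , refl)) (inj₂ (refl , refl)) = inj₁ (refl , refl)

  ≐-cancelˡ : (A : Pair₂ m) {x y z : Fin m} → A ≐⟨ x , y ⟩ → A ≐⟨ x , z ⟩ → y ≡ z
  ≐-cancelˡ A p q with ≐-elements A p q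
  ... | inj₁ (_ , y≡z)     = y≡z
  ... | inj₂ (x≡z , y≡x) = trans y≡x x≡z

  ≐-unique : (A B : Pair₂ m) {x y : Fin m} → A ≐⟨ x , y ⟩ → B ≐⟨ x , y ⟩ → A ≡ B
  ≐-unique (_ , p) (_ , q) (inj₁ (refl , refl)) (inj₁ (refl , refl)) = cong (_ ,_) (<-irrelevant p q)
  ≐-unique (_ , p) (_ , q) (inj₁ (refl , refl)) (inj₂ (refl , refl)) = ⊥-elim (<-asym p q)
  ≐-unique (_ , p) (_ , q) (inj₂ (refl , refl)) (inj₁ (refl , refl)) = ⊥-elim (<-asym p q)
  ≐-unique (_ , p) (_ , q) (inj₂ (refl , refl)) (inj₂ (refl , refl)) = cong (_ ,_) (<-irrelevant p q)

  pairOf : {x y : Fin m} → x ≢ y → ∃[ A ] A ≐⟨ x , y ⟩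
  pairOf {x} {y} x≢y with <-cmp x y
  ... | tri< x<y _ _   = ((x , y) , x<y) , inj₁ (refl , refl)
  ... | tri≈ _ x≡y _ = ⊥-elim (x≢y x≡y)
  ... | tri> _ _ y<x   = ((y , x) , y<x) , inj₂ (refl , refl)

  module _ {adj : Fin m → Fin m → Set} where

    TokAdj-sym : Symmetric adj → Symmetric (TokAdj adj)
    TokAdj-sym sym-adj (x , y , z , A≐xy , B≐xz , yz) = x , z , y , B≐xz , A≐xy , sym-adj yz

    TokAdj-irreflexive : Irreflexive _≡_ adj → (A : Pair₂ m) → ¬ TokAdj adj A A
    TokAdj-irreflexive loopless A (x , y , z , A≐xy , A≐xz , yz) with ≐-elements A A≐xy A≐xz
    ... | inj₁ (_ , refl)   = loopless refl yz
    ... | inj₂ (refl , refl) = ≐-distinct A A≐xy refl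

    TokAdj-neighbour : (X Y : Pair₂ m) {a b : Fin m} → X ≐⟨ a , b ⟩ → TokAdj adj X Y →
      (∃[ w ] Y ≐⟨ a , w ⟩ × adj b w) ⊎ (∃[ w ] Y ≐⟨ b , w ⟩ × adj a w)
    TokAdj-neighbour X Y X≐ab (x , y , z , X≐xy , Y≐xz , yz) with ≐-elements X X≐ab X≐xy
    ... | inj₁ (refl , refl) = inj₁ (z , Y≐xz , yz)
    ... | inj₂ (refl , refl) = inj₂ (z , Y≐xz , yz)

    TokAdj-commonNeighbour : Irreflexive _≡_ adj → (X Y Z : Pair₂ m) {a b c : Fin m} →
      X ≐⟨ a , b ⟩ → Y ≐⟨ a , c ⟩ → adj b c → TokAdj adj X Z → TokAdj adj Y Z →
      (∃[ w ] Z ≐⟨ a , w ⟩ × adj b w × adj c w) ⊎ (Z ≐⟨ b , c ⟩ × adj a b × adj a c)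
    TokAdj-commonNeighbour loopless X Y Z X≐ab Y≐ac bc XZ YZ
      with TokAdj-neighbour X Z X≐ab XZ | TokAdj-neighbour Y Z Y≐ac YZ
    ... | inj₁ (w , Z≐aw , bw) | inj₁ (v , Z≐av , cv) with ≐-cancelˡ Z Z≐aw Z≐av
    ...   | refl = inj₁ (w , Z≐aw , bw , cv)
    TokAdj-commonNeighbour loopless X Y Z X≐ab Y≐ac bc XZ YZ
        | inj₁ (w , Z≐aw , _) | inj₂ (v , Z≐cv , av) with ≐-elements Z Z≐aw Z≐cv
    ...   | inj₁ (refl , _) = ⊥-elim (≐-distinct Y Y≐ac refl)
    ...   | inj₂ (refl , _) = ⊥-elim (loopless refl av)
    TokAdj-commonNeighbour loopless X Y Z X≐ab Y≐ac bc XZ YZ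
        | inj₂ (w , Z≐bw , aw) | inj₁ (v , Z≐av , _) with ≐-elements Z Z≐bw Z≐av
    ...   | inj₁ (refl , _) = ⊥-elim (≐-distinct X X≐ab refl)
    ...   | inj₂ (refl , refl) = ⊥-elim (loopless refl aw)
    TokAdj-commonNeighbour loopless X Y Z X≐ab Y≐ac bc XZ YZ
        | inj₂ (w , Z≐bw , aw) | inj₂ (v , Z≐cv , av) with ≐-elements Z Z≐bw Z≐cv
    ...   | inj₁ (refl , _)    = ⊥-elim (loopless refl bc)
    ...   | inj₂ (refl , refl) = inj₂ (Z≐bw , av , aw)

-- The cycle

Cycle : ℕ → Graph
Cycle n = record { V = Fin n ; Adj = CycAdj n }

CycAdj-sym : {n : ℕ} → Symmetric (CycAdj n)
CycAdj-sym (inj₁ e)                 = inj₂ (inj₁ e)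
CycAdj-sym (inj₂ (inj₁ e))          = inj₁ e
CycAdj-sym (inj₂ (inj₂ (inj₁ e))) = inj₂ (inj₂ (inj₂ e))
CycAdj-sym (inj₂ (inj₂ (inj₂ e))) = inj₂ (inj₂ (inj₁ e))

module _ {m : ℕ} where

  next : Fin (suc m) → Fin (suc m)
  next i with suc (toℕ i) <? suc m
  ... | yes i+1<n = fromℕ< i+1<n
  ... | no  _     = fz

  next-view : (i : Fin (suc m)) →
      (toℕ (next i) ≡ suc (toℕ i) × suc (toℕ i) < suc m)
    ⊎ (toℕ (next i) ≡ 0 × suc (toℕ i) ≡ suc m)
  next-view i with suc (toℕ i) <? suc m
  ... | yes i+1<n = inj₁ (toℕ-fromℕ< i+1<n , i+1<n)
  ... | no  i+1≮n = inj₂ (refl , ≤-antisym (toℕ<n i) (≮⇒≥ i+1≮n))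

  next-injective : {i j : Fin (suc m)} → next i ≡ next j → i ≡ j
  next-injective {i} {j} eq with next-view i | next-view j
  ... | inj₁ (p , _) | inj₁ (q , _) =
    toℕ-injective (ℕ.suc-injective (trans (sym p) (trans (cong toℕ eq) q)))
  ... | inj₁ (p , _) | inj₂ (q , _) with () ← trans (sym p) (trans (cong toℕ eq) q)
  ... | inj₂ (p , _) | inj₁ (q , _) with () ← trans (sym q) (trans (cong toℕ (sym eq)) p)
  ... | inj₂ (_ , p) | inj₂ (_ , q) = toℕ-injective (ℕ.suc-injective (trans p (sym q)))

  next-adjacent : (i : Fin (suc m)) → CycAdj (suc m) i (next i)
  next-adjacent i with next-view i
  ... | inj₁ (p , _) = inj₁ (sym p)
  ... | inj₂ (p , q) = inj₂ (inj₂ (inj₂ (p , q)))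

  next-from-suc : {i j : Fin (suc m)} → suc (toℕ i) ≡ toℕ j → j ≡ next i
  next-from-suc {i} {j} e with next-view i
  ... | inj₁ (p , _) = toℕ-injective (trans (sym e) (sym p))
  ... | inj₂ (_ , q) = ⊥-elim (<-irrefl (trans (sym e) q) (toℕ<n j))

  next-from-wrap : {i j : Fin (suc m)} → toℕ j ≡ 0 → suc (toℕ i) ≡ suc m → j ≡ next i
  next-from-wrap {i} e i+1≡n with next-view i
  ... | inj₁ (_ , i+1<n) = ⊥-elim (<-irrefl i+1≡n i+1<n)
  ... | inj₂ (p , _)     = toℕ-injective (trans e (sym p))

  CycAdj⇒next : {i j : Fin (suc m)} → CycAdj (suc m) i j → j ≡ next i ⊎ i ≡ next j
  CycAdj⇒next (inj₁ e)                         = inj₁ (next-from-suc e)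
  CycAdj⇒next (inj₂ (inj₁ e))                  = inj₂ (next-from-suc e)
  CycAdj⇒next (inj₂ (inj₂ (inj₁ (e , f)))) = inj₂ (next-from-wrap e f)
  CycAdj⇒next (inj₂ (inj₂ (inj₂ (e , f)))) = inj₁ (next-from-wrap e f)

  -- k ≤ n steps around the cycle wrap past the last vertex at most once.
  toℕ-iterate-next : (i : Fin (suc m)) (k : ℕ) → k ≤ suc m →
    toℕ (fold i next k) ≡ toℕ i + k ⊎ toℕ (fold i next k) + suc m ≡ toℕ i + k
  toℕ-iterate-next i zero    _   = inj₁ (sym (+-identityʳ (toℕ i)))
  toℕ-iterate-next i (suc k) k<n
    with toℕ-iterate-next i k (<⇒≤ k<n) | next-view (fold i next k)
  ... | inj₁ h | inj₁ (p , _) = inj₁ (begin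
    toℕ (next x)       ≡⟨ p ⟩
    suc (toℕ x)        ≡⟨ cong suc h ⟩
    suc (toℕ i + k)    ≡⟨ +-suc (toℕ i) k ⟨
    toℕ i + suc k      ∎)
    where x = fold i next k
  ... | inj₁ h | inj₂ (p , q) = inj₂ (begin
    toℕ (next x) + suc m ≡⟨ cong (_+ suc m) p ⟩
    suc m                ≡⟨ q ⟨
    suc (toℕ x)          ≡⟨ cong suc h ⟩
    suc (toℕ i + k)      ≡⟨ +-suc (toℕ i) k ⟨
    toℕ i + suc k        ∎)
    where x = fold i next k
  ... | inj₂ h | inj₁ (p , _) = inj₂ (begin
    toℕ (next x) + suc m ≡⟨ cong (_+ suc m) p ⟩
    suc (toℕ x + suc m)  ≡⟨ cong suc h ⟩
    suc (toℕ i + k)      ≡⟨ +-suc (toℕ i) k ⟨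
    toℕ i + suc k        ∎)
    where x = fold i next k
  ... | inj₂ h | inj₂ (_ , q) = ⊥-elim (<-irrefl (sym twice-round) (s≤s (+-mono-≤ (≤-pred (toℕ<n i)) k<n)))
    where
    x = fold i next k
    twice-round : suc m + suc m ≡ toℕ i + suc k
    twice-round = begin
      suc m + suc m        ≡⟨ cong (_+ suc m) q ⟨
      suc (toℕ x + suc m)  ≡⟨ cong suc h ⟩
      suc (toℕ i + k)      ≡⟨ +-suc (toℕ i) k ⟨
      toℕ i + suc k        ∎

  iterate-next-≢ : (i : Fin (suc m)) (k : ℕ) → 0 < k → k < suc m → fold i next k ≢ i
  iterate-next-≢ i k 0<k k<n eq with toℕ-iterate-next i k (<⇒≤ k<n)
  ... | inj₁ h = <-irrefl (+-cancelˡ-≡ (toℕ i) 0 k (begin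
    toℕ i + 0             ≡⟨ +-identityʳ (toℕ i) ⟩
    toℕ i                 ≡⟨ cong toℕ eq ⟨
    toℕ (fold i next k)   ≡⟨ h ⟩
    toℕ i + k             ∎)) 0<k
  ... | inj₂ h = <-irrefl (+-cancelˡ-≡ (toℕ i) k (suc m) (begin
    toℕ i + k                   ≡⟨ h ⟨
    toℕ (fold i next k) + suc m ≡⟨ cong (λ j → toℕ j + suc m) eq ⟩
    toℕ i + suc m               ∎)) k<n

  module _ (n≥4 : 4 ≤ suc m) where

    next-≢ : (i : Fin (suc m)) → next i ≢ i
    next-≢ i = iterate-next-≢ i 1 (s≤s z≤n) (<⇒≤ (<⇒≤ n≥4))

    next²-≢ : (i : Fin (suc m)) → next (next i) ≢ i
    next²-≢ i = iterate-next-≢ i 2 (s≤s z≤n) (<⇒≤ n≥4)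

    next³-≢ : (i : Fin (suc m)) → next (next (next i)) ≢ i
    next³-≢ i = iterate-next-≢ i 3 (s≤s z≤n) n≥4

    CycAdj-irreflexive : Irreflexive _≡_ (CycAdj (suc m))
    CycAdj-irreflexive {i} refl ii with CycAdj⇒next ii
    ... | inj₁ e = next-≢ i (sym e)
    ... | inj₂ e = next-≢ i (sym e)

    CycAdj-triangleFree : {a b c : Fin (suc m)} →
      CycAdj (suc m) a b → CycAdj (suc m) b c → CycAdj (suc m) a c → ⊥
    CycAdj-triangleFree ab bc ac with CycAdj⇒next ab | CycAdj⇒next bc | CycAdj⇒next ac
    ... | inj₁ refl | inj₁ refl | inj₁ e    = next-≢ _ (next-injective e)
    ... | inj₁ refl | inj₁ refl | inj₂ e    = next³-≢ _ (sym e)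
    ... | inj₁ refl | inj₂ e    | _         = CycAdj-irreflexive (next-injective e) ac
    ... | inj₂ refl | inj₁ refl | _         = CycAdj-irreflexive refl ac
    ... | inj₂ refl | inj₂ refl | inj₁ e    = next³-≢ _ (sym e)
    ... | inj₂ refl | inj₂ refl | inj₂ e    = next-≢ _ (next-injective e)

-- The wheel

lift₁-inverse : {n : ℕ} {f g : Fin n → Fin n} → (∀ x → f (g x) ≡ x) →
                (x : Fin (suc n)) → lift 1 f (lift 1 g x) ≡ x
lift₁-inverse _   fz     = refl
lift₁-inverse f∘g (fs x) = cong fs (f∘g x)

extendToWheel : {n : ℕ} → Automorphism (Cycle n) → Automorphism (Wheel n)
extendToWheel {n} σ = record
  { perm     = mk↔ₛ′ (lift 1 ⟦ σ ⟧) (lift 1 ⟦ σ ⁻¹ ⟧) (lift₁-inverse (⁻¹-inverseˡ σ)) (lift₁-inverse (⁻¹-inverseʳ σ))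
  ; preserve = preserve′
  ; reflect  = reflect′
  }
  where
  open Automorphism σ
  preserve′ : ∀ x y → WheelAdj n x y → WheelAdj n (lift 1 ⟦ σ ⟧ x) (lift 1 ⟦ σ ⟧ y)
  preserve′ fz     (fs _) _  = tt
  preserve′ (fs _) fz     _  = tt
  preserve′ (fs i) (fs j) ij = preserve i j ij
  reflect′ : ∀ x y → WheelAdj n (lift 1 ⟦ σ ⟧ x) (lift 1 ⟦ σ ⟧ y) → WheelAdj n x y
  reflect′ fz     (fs _) _  = tt
  reflect′ (fs _) fz     _  = tt
  reflect′ (fs i) (fs j) ij = reflect i j ij

module WheelTokens {m : ℕ} (n≥4 : 4 ≤ suc m) where

  private
    n : ℕ
    n = suc m

  Pair : Set
  Pair = Pair₂ (suc n)

  F₂W : Graph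
  F₂W = Token₂ (suc n) (WheelAdj n)

  _~_ : Pair → Pair → Set
  _~_ = TokAdj (WheelAdj n)

  WheelAdj-sym : Symmetric (WheelAdj n)
  WheelAdj-sym {fz}   {fs _} _  = tt
  WheelAdj-sym {fs _} {fz}   _  = tt
  WheelAdj-sym {fs _} {fs _} ij = CycAdj-sym ij

  WheelAdj-irreflexive : Irreflexive _≡_ (WheelAdj n)
  WheelAdj-irreflexive {fz}   refl ()
  WheelAdj-irreflexive {fs _} refl ii = CycAdj-irreflexive n≥4 refl ii

  ~-sym : (A B : Pair) → A ~ B → B ~ A
  ~-sym A B = TokAdj-sym WheelAdj-sym {A} {B}

  ~-irrefl : (A : Pair) → ¬ A ~ A
  ~-irrefl = TokAdj-irreflexive WheelAdj-irreflexive

  rimEdge-commonNeighbour : {j k : Fin n} {w : Fin (suc n)} → CycAdj n j k →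
    WheelAdj n (fs j) w → WheelAdj n (fs k) w → w ≡ fz
  rimEdge-commonNeighbour {w = fz}   _  _  _  = refl
  rimEdge-commonNeighbour {w = fs _} jk jw kw = ⊥-elim (CycAdj-triangleFree n≥4 jk kw jw)

  spoke : Fin n → Pair
  spoke k = (fz , fs k) , s≤s z≤n

  spoke-injective : {a b : Fin n} → spoke a ≡ spoke b → a ≡ b
  spoke-injective refl = refl

  ≐-spoke : (A : Pair) {k : Fin n} → A ≐⟨ fs k , fz ⟩ → A ≡ spoke k
  ≐-spoke A A≐k0 = ≐-unique A _ A≐k0 (inj₂ (refl , refl))

  rim≢spoke : (A : Pair) {i j k : Fin n} → A ≐⟨ fs i , fs j ⟩ → A ≢ spoke k
  rim≢spoke _ (inj₁ (() , _)) refl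
  rim≢spoke _ (inj₂ (() , _)) refl

  spoke-or-rim : (A : Pair) → (∃[ k ] A ≡ spoke k) ⊎ (∃₂ λ i j → A ≐⟨ fs i , fs j ⟩)
  spoke-or-rim ((fz   , fz)   , ())
  spoke-or-rim ((fz   , fs k) , s≤s z≤n) = inj₁ (k , refl)
  spoke-or-rim ((fs _ , fz)   , ())
  spoke-or-rim ((fs i , fs j) , _) = inj₂ (i , j , inj₁ (refl , refl))

  spoke~spoke : {a b : Fin n} → CycAdj n a b → spoke a ~ spoke b
  spoke~spoke ab = fz , _ , _ , inj₁ (refl , refl) , inj₁ (refl , refl) , ab

  spoke~spoke⁻¹ : {a b : Fin n} → spoke a ~ spoke b → CycAdj n a b
  spoke~spoke⁻¹ (_ , _ , _ , inj₁ (refl , refl) , inj₁ (refl , refl) , ab) = ab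
  spoke~spoke⁻¹ (_ , _ , _ , inj₁ (refl , refl) , inj₂ (_ , ()) , _)
  spoke~spoke⁻¹ (_ , _ , _ , inj₂ (refl , refl) , inj₁ (() , _) , _)
  spoke~spoke⁻¹ (_ , _ , _ , inj₂ (refl , refl) , inj₂ (refl , refl) , ())

  spoke~rim : (A : Pair) {i k : Fin n} → A ≐⟨ fs i , fs k ⟩ → spoke i ~ A
  spoke~rim _ A≐ik = _ , fz , _ , inj₂ (refl , refl) , A≐ik , tt

  spoke~rim⁻¹ : (B : Pair) {k c d : Fin n} → spoke k ~ B → B ≐⟨ fs c , fs d ⟩ → k ≡ c ⊎ k ≡ d
  spoke~rim⁻¹ B (_ , _ , _ , inj₁ (refl , refl) , B≐0z , _) B≐cd with ≐-elements B B≐0z B≐cd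
  ... | inj₁ (() , _)
  ... | inj₂ (() , _)
  spoke~rim⁻¹ B (_ , _ , _ , inj₂ (refl , refl) , B≐kz , _) B≐cd with ≐-elements B B≐kz B≐cd
  ... | inj₁ (refl , _) = inj₁ refl
  ... | inj₂ (refl , _) = inj₂ refl

  rim-determined : (B : Pair) {a b c d : Fin n} → B ≐⟨ fs c , fs d ⟩ →
    spoke a ~ B → spoke b ~ B → a ≢ b → B ≐⟨ fs a , fs b ⟩
  rim-determined B B≐cd aB bB a≢b with spoke~rim⁻¹ B aB B≐cd | spoke~rim⁻¹ B bB B≐cd
  ... | inj₁ refl | inj₂ refl = B≐cd
  ... | inj₂ refl | inj₁ refl = ≐-swap B B≐cd
  ... | inj₁ refl | inj₁ refl = ⊥-elim (a≢b refl)
  ... | inj₂ refl | inj₂ refl = ⊥-elim (a≢b refl)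

  rim-commonNeighbour : (X Y Z : Pair) {i j k : Fin n} → X ≐⟨ fs i , fs j ⟩ → Y ≐⟨ fs i , fs k ⟩ →
    CycAdj n j k → X ~ Z → Y ~ Z → Z ≡ spoke i
  rim-commonNeighbour X Y Z X≐ij Y≐ik jk XZ YZ
    with TokAdj-commonNeighbour WheelAdj-irreflexive X Y Z X≐ij Y≐ik jk XZ YZ
  ... | inj₂ (_ , ij , ik) = ⊥-elim (CycAdj-triangleFree n≥4 ij jk ik)
  ... | inj₁ (w , Z≐iw , jw , kw) with rimEdge-commonNeighbour jk jw kw
  ...   | refl = ≐-spoke Z Z≐iw

  twoCommonNeighbours⇒spoke : (X Y Z₁ Z₂ : Pair) {i j : Fin n} → X ≐⟨ fs i , fs j ⟩ → X ~ Y →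
    X ~ Z₁ → Y ~ Z₁ → X ~ Z₂ → Y ~ Z₂ → Z₁ ≢ Z₂ → Y ≡ spoke i ⊎ Y ≡ spoke j
  twoCommonNeighbours⇒spoke X Y Z₁ Z₂ X≐ij XY XZ₁ YZ₁ XZ₂ YZ₂ Z₁≢Z₂ with TokAdj-neighbour X Y X≐ij XY
  ... | inj₁ (fz , Y≐i0 , _) = inj₁ (≐-spoke Y Y≐i0)
  ... | inj₂ (fz , Y≐j0 , _) = inj₂ (≐-spoke Y Y≐j0)
  ... | inj₁ (fs k , Y≐ik , jk) = ⊥-elim (Z₁≢Z₂ (trans
          (rim-commonNeighbour X Y Z₁ X≐ij Y≐ik jk XZ₁ YZ₁)
          (sym (rim-commonNeighbour X Y Z₂ X≐ij Y≐ik jk XZ₂ YZ₂))))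
  ... | inj₂ (fs k , Y≐jk , ik) = ⊥-elim (Z₁≢Z₂ (trans
          (rim-commonNeighbour X Y Z₁ (≐-swap X X≐ij) Y≐jk ik XZ₁ YZ₁)
          (sym (rim-commonNeighbour X Y Z₂ (≐-swap X X≐ij) Y≐jk ik XZ₂ YZ₂))))

  rim-noWalk : (X : Pair) {i j : Fin n} → X ≐⟨ fs i , fs j ⟩ → ¬ NeighbourhoodWalk₄ F₂W X
  rim-noWalk X X≐ij w = no-three-distinct-among-two
    (twoCommonNeighbours⇒spoke X y₂ y₁ y₃ X≐ij X~y₂ X~y₁ (~-sym y₁ y₂ y₁~y₂) X~y₃ y₂~y₃ y₁≢y₃)
    (twoCommonNeighbours⇒spoke X y₃ y₂ y₄ X≐ij X~y₃ X~y₂ (~-sym y₂ y₃ y₂~y₃) X~y₄ y₃~y₄ y₂≢y₄)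
    (twoCommonNeighbours⇒spoke X y₄ y₃ y₅ X≐ij X~y₄ X~y₃ (~-sym y₃ y₄ y₃~y₄) X~y₅ y₄~y₅ y₃≢y₅)
    (adjacent⇒≢ y₂ y₃ y₂~y₃) (adjacent⇒≢ y₃ y₄ y₃~y₄) y₂≢y₄
    where
    open NeighbourhoodWalk₄ w
    adjacent⇒≢ : (A B : Pair) → A ~ B → A ≢ B
    adjacent⇒≢ A _ AB refl = ~-irrefl A AB

  -- Around spoke i: {v,u_{i+1}}, {u_i,u_{i+1}}, {u_i,u_{i+2}}, {u_i,u_{i+3}}, and then
  -- {v,u_{i+3}} when n = 4, {u_i,u_{i+4}} otherwise.
  module _ (i : Fin n) where
    private
      s₁ s₂ s₃ : Fin n
      s₁ = next i
      s₂ = next s₁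
      s₃ = next s₂

      s₁≢i : s₁ ≢ i
      s₁≢i = next-≢ n≥4 i
      s₂≢i : s₂ ≢ i
      s₂≢i = next²-≢ n≥4 i
      s₃≢i : s₃ ≢ i
      s₃≢i = next³-≢ n≥4 i

      rim : (k : Fin n) → k ≢ i → Pair
      rim k k≢i = proj₁ (pairOf (k≢i ∘ sym ∘ suc-injective))

      rim-≐ : (k : Fin n) (k≢i : k ≢ i) → rim k k≢i ≐⟨ fs i , fs k ⟩
      rim-≐ k k≢i = proj₂ (pairOf (k≢i ∘ sym ∘ suc-injective))

      rim-injective : {k l : Fin n} (k≢i : k ≢ i) (l≢i : l ≢ i) → rim k k≢i ≡ rim l l≢i → k ≡ l
      rim-injective {k} {l} k≢i l≢i eq =
        suc-injective (≐-cancelˡ (rim l l≢i) (subst (_≐⟨ fs i , fs k ⟩) eq (rim-≐ k k≢i)) (rim-≐ l l≢i))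

      rim~rim : (k : Fin n) (k≢i : k ≢ i) (k+1≢i : next k ≢ i) → rim k k≢i ~ rim (next k) k+1≢i
      rim~rim k k≢i k+1≢i = fs i , fs k , fs (next k) , rim-≐ k k≢i , rim-≐ (next k) k+1≢i , next-adjacent k

      walkVia : (y₅ : Pair) → spoke i ~ y₅ → rim s₃ s₃≢i ~ y₅ → rim s₂ s₂≢i ≢ y₅ →
                NeighbourhoodWalk₄ F₂W (spoke i)
      walkVia y₅ X~y₅ y₄~y₅ y₃≢y₅ = record
        { y₁ = spoke s₁ ; y₂ = rim s₁ s₁≢i ; y₃ = rim s₂ s₂≢i ; y₄ = rim s₃ s₃≢i ; y₅ = y₅
        ; X~y₁ = spoke~spoke (next-adjacent i)
        ; X~y₂ = spoke~rim (rim s₁ s₁≢i) (rim-≐ s₁ s₁≢i)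
        ; X~y₃ = spoke~rim (rim s₂ s₂≢i) (rim-≐ s₂ s₂≢i)
        ; X~y₄ = spoke~rim (rim s₃ s₃≢i) (rim-≐ s₃ s₃≢i)
        ; X~y₅ = X~y₅
        ; y₁~y₂ = spoke~rim (rim s₁ s₁≢i) (≐-swap (rim s₁ s₁≢i) (rim-≐ s₁ s₁≢i))
        ; y₂~y₃ = rim~rim s₁ s₁≢i s₂≢i
        ; y₃~y₄ = rim~rim s₂ s₂≢i s₃≢i
        ; y₄~y₅ = y₄~y₅
        ; y₁≢y₃ = rim≢spoke (rim s₂ s₂≢i) (rim-≐ s₂ s₂≢i) ∘ sym
        ; y₂≢y₄ = next²-≢ n≥4 s₁ ∘ sym ∘ rim-injective s₁≢i s₃≢i
        ; y₃≢y₅ = y₃≢y₅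
        }

    spoke-walk : NeighbourhoodWalk₄ F₂W (spoke i)
    spoke-walk with next s₃ ≟ i
    ... | yes s₄≡i = walkVia (spoke s₃)
            (spoke~spoke (CycAdj-sym (subst (CycAdj n s₃) s₄≡i (next-adjacent s₃))))
            (~-sym (spoke s₃) (rim s₃ s₃≢i) (spoke~rim (rim s₃ s₃≢i) (≐-swap (rim s₃ s₃≢i) (rim-≐ s₃ s₃≢i))))
            (rim≢spoke (rim s₂ s₂≢i) (rim-≐ s₂ s₂≢i))
    ... | no s₄≢i = walkVia (rim (next s₃) s₄≢i)
            (spoke~rim (rim (next s₃) s₄≢i) (rim-≐ (next s₃) s₄≢i))
            (rim~rim s₃ s₃≢i s₄≢i)
            (next²-≢ n≥4 s₂ ∘ sym ∘ rim-injective s₂≢i s₄≢i)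

  spoke-image : (α : Automorphism F₂W) (k : Fin n) → ∃[ l ] ⟦ α ⟧ (spoke k) ≡ spoke l
  spoke-image α k with spoke-or-rim (⟦ α ⟧ (spoke k))
  ... | inj₁ image = image
  ... | inj₂ (_ , _ , rim) =
    ⊥-elim (rim-noWalk (⟦ α ⟧ (spoke k)) rim (NeighbourhoodWalk₄-transport α (spoke-walk k)))

  rimMap : Automorphism F₂W → Fin n → Fin n
  rimMap α k = proj₁ (spoke-image α k)

  rimMap-spoke : (α : Automorphism F₂W) (k : Fin n) → ⟦ α ⟧ (spoke k) ≡ spoke (rimMap α k)
  rimMap-spoke α k = proj₂ (spoke-image α k)

  rimMap-inverseˡ : (α : Automorphism F₂W) (k : Fin n) → rimMap α (rimMap (α ⁻¹) k) ≡ k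
  rimMap-inverseˡ α k = spoke-injective (begin
    spoke (rimMap α (rimMap (α ⁻¹) k)) ≡⟨ rimMap-spoke α _ ⟨
    ⟦ α ⟧ (spoke (rimMap (α ⁻¹) k))    ≡⟨ cong ⟦ α ⟧ (rimMap-spoke (α ⁻¹) k) ⟨
    ⟦ α ⟧ (⟦ α ⁻¹ ⟧ (spoke k))          ≡⟨ ⁻¹-inverseˡ α (spoke k) ⟩
    spoke k                             ∎)

  rimMap-inverseʳ : (α : Automorphism F₂W) (k : Fin n) → rimMap (α ⁻¹) (rimMap α k) ≡ k
  rimMap-inverseʳ α k = spoke-injective (begin
    spoke (rimMap (α ⁻¹) (rimMap α k)) ≡⟨ rimMap-spoke (α ⁻¹) _ ⟨
    ⟦ α ⁻¹ ⟧ (spoke (rimMap α k))      ≡⟨ cong ⟦ α ⁻¹ ⟧ (rimMap-spoke α k) ⟨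
    ⟦ α ⁻¹ ⟧ (⟦ α ⟧ (spoke k))          ≡⟨ ⁻¹-inverseʳ α (spoke k) ⟩
    spoke k                             ∎)

  rimMap-injective : (α : Automorphism F₂W) {a b : Fin n} → rimMap α a ≡ rimMap α b → a ≡ b
  rimMap-injective α {a} {b} eq = begin
    a                          ≡⟨ rimMap-inverseʳ α a ⟨
    rimMap (α ⁻¹) (rimMap α a) ≡⟨ cong (rimMap (α ⁻¹)) eq ⟩
    rimMap (α ⁻¹) (rimMap α b) ≡⟨ rimMap-inverseʳ α b ⟩
    b                          ∎

  rimMap-adjacent : (α : Automorphism F₂W) {a b : Fin n} → CycAdj n a b → CycAdj n (rimMap α a) (rimMap α b)
  rimMap-adjacent α {a} {b} ab = spoke~spoke⁻¹
    (subst₂ _~_ (rimMap-spoke α a) (rimMap-spoke α b) (preserve (spoke a) (spoke b) (spoke~spoke ab)))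
    where open Automorphism α

  rimAut : Automorphism F₂W → Automorphism (Cycle n)
  rimAut α = record
    { perm     = mk↔ₛ′ (rimMap α) (rimMap (α ⁻¹)) (rimMap-inverseˡ α) (rimMap-inverseʳ α)
    ; preserve = λ _ _ → rimMap-adjacent α
    ; reflect  = λ a b ab →
        subst₂ (CycAdj n) (rimMap-inverseʳ α a) (rimMap-inverseʳ α b) (rimMap-adjacent (α ⁻¹) ab)
    }

  rim-image : (α : Automorphism F₂W) (A : Pair) {i j : Fin n} → A ≐⟨ fs i , fs j ⟩ →
              ⟦ α ⟧ A ≐⟨ fs (rimMap α i) , fs (rimMap α j) ⟩
  rim-image α A {i} {j} A≐ij with spoke-or-rim (⟦ α ⟧ A)
  ... | inj₁ (k , αA≡spoke) = ⊥-elim (rim≢spoke A A≐ij (begin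
    A                          ≡⟨ ⁻¹-inverseʳ α A ⟨
    ⟦ α ⁻¹ ⟧ (⟦ α ⟧ A)         ≡⟨ cong ⟦ α ⁻¹ ⟧ αA≡spoke ⟩
    ⟦ α ⁻¹ ⟧ (spoke k)         ≡⟨ rimMap-spoke (α ⁻¹) k ⟩
    spoke (rimMap (α ⁻¹) k)    ∎))
  ... | inj₂ (_ , _ , αA≐cd) = rim-determined (⟦ α ⟧ A) αA≐cd
    (spoke~image A≐ij) (spoke~image (≐-swap A A≐ij))
    (≐-distinct A A≐ij ∘ cong fs ∘ rimMap-injective α)
    where
    open Automorphism α
    spoke~image : {k l : Fin n} → A ≐⟨ fs k , fs l ⟩ → spoke (rimMap α k) ~ ⟦ α ⟧ A
    spoke~image {k} A≐kl =
      subst (_~ ⟦ α ⟧ A) (rimMap-spoke α k) (preserve (spoke k) A (spoke~rim A A≐kl))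

  induced : (φ : Automorphism F₂W) → InducedBy {suc n} {WheelAdj n} φ (extendToWheel (rimAut φ))
  induced φ ((fz   , fz)   , ())
  induced φ ((fs _ , fz)   , ())
  induced φ ((fz   , fs k) , s≤s z≤n) =
    subst (_≐⟨ fz , fs (rimMap φ k) ⟩) (sym (rimMap-spoke φ k)) (inj₁ (refl , refl))
  induced φ A@((fs _ , fs _) , _) = rim-image φ A (inj₁ (refl , refl))

mainTheorem10 : (n : ℕ) → 4 ≤ n →
    (φ : Automorphism (Token₂ (suc n) (WheelAdj n))) →
    ∃[ θ ] InducedBy {suc n} {WheelAdj n} φ θ
mainTheorem10 zero    ()
mainTheorem10 (suc m) n≥4 φ = extendToWheel (rimAut φ) , induced φ
  where open WheelTokens n≥4
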